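{- Let $S=\{0,1,2\}$ and $s_0=0$. Then every colouring of $\mathbb{Q}$ with finitely many colours and using more than one colour contains an almost-monochromatic positive homothet of $(S,s_0)$; that is, there exist $a\in\mathbb{Q}$ and $\lambda\in\mathbb{Q}_{>0}$ such that $a+\lambda$ and $a+2\lambda$ have the same colour while $a$ has a different colour.
   Context: A positive homothet of $(S,s_0)$ is $(c+\lambda S, c+\lambda s_0)$ with $\lambda>0$; it is almost-monochromatic if $(c+\lambda S)\setminus\{c+\lambda s_0\}$ is monochromatic but $c+\lambda S$ is not. -}

module Defs where

open import Data.Nat using (ℕ)
open import Data.Fin using (Fin)
open import Data.Rational using (ℚ; _+_; _*_; _<_; 0ℚ; 1ℚ)
open import Data.Product using (Σ; _×_; ∃)
open import Relation.Binary.PropositionalEquality using (_≡_; _≢_)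

Colouring : ℕ → Set
Colouring k = ℚ → Fin k

UsesMoreThanOneColour : ∀ {k} → Colouring k → Set
UsesMoreThanOneColour c = Σ ℚ λ x → Σ ℚ λ y → c x ≢ c y

2ℚ : ℚ
2ℚ = 1ℚ + 1ℚ

AlmostMonoHomothet : ∀ {k} → Colouring k → ℚ → ℚ → Set
AlmostMonoHomothet c a l =
  (0ℚ < l) × (c (a + l) ≡ c (a + 2ℚ * l)) × (c a ≢ c (a + l))

module Submission where

open import Defs
open import Data.Nat using (ℕ)
open import Data.Rational using (ℚ)
open import Data.Product using (Σ)

-- Let c x ≢ c y with x < y.  Fix naturals a₀ < … < aₖ such that
-- any two differ by a divisor of the smaller one (a "divisor chain", built by
-- repeatedly adjoining the product Π below the translate Π + chain), and cut
-- [x , y] into Π equal steps of length δ.  Among the k + 1 points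
-- x + (Π + aᵢ)δ two share a colour, say for aᵢ < aⱼ; their gap g = aⱼ - aᵢ
-- divides aᵢ and Π.  Walking down the progression x + t·gδ from that
-- monochromatic pair, the colour must change before reaching
-- y = x + (Π/g)·gδ, since c x ≢ c y; the first change found, between the
-- points t and t + 1 while t + 1 and t + 2 agree, is an almost-monochromatic
-- homothet (a , λ) = (x + t·gδ , gδ).

open import Data.Nat as ℕ using (zero; suc; _≤_; z≤n; s≤s)
import Data.Nat.Properties as ℕP
open import Data.Nat.Divisibility using (_∣_; divides; ∣-trans; ∣m∣n⇒∣m+n)
open import Data.Nat.ListAction using (product)
open import Data.Nat.ListAction.Properties using (∈⇒∣product; product≢0)
open import Data.List using (tabulate)
open import Data.List.Membership.Propositional.Properties using (∈-tabulate⁺)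
open import Data.List.Relation.Unary.All.Properties using (tabulate⁺)
open import Data.Fin as F using (Fin)
open import Data.Fin.Properties using (pigeonhole)
open import Data.Product using (_×_; _,_)
open import Data.Sum using (inj₁; inj₂)
open import Data.Empty using (⊥-elim)
open import Function using (_∘_)
open import Relation.Nullary using (yes; no)
open import Relation.Binary using (tri<; tri≈; tri>)
open import Relation.Binary.Definitions using (DecidableEquality)
open import Relation.Binary.PropositionalEquality
open import Data.Rational as ℚ using (0ℚ; 1ℚ; 1/_; _+_; _-_; _*_; _<_)
import Data.Rational.Properties as ℚP
open import Data.Rational.Solver using (module +-*-Solver)
open import Algebra.Bundles using (CommutativeRing)
open import Algebra.Properties.Semiring.Mult
  (CommutativeRing.semiring ℚP.+-*-commutativeRing)
  using (×-assocˡ; ×-assoc-*) renaming (_×_ to _·_)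

HasAlmostMonoHomothet : ∀ {k} → Colouring k → Set
HasAlmostMonoHomothet c = Σ ℚ λ a → Σ ℚ λ l → AlmostMonoHomothet c a l

UnitBreak : ∀ {a} {A : Set a} → (ℕ → A) → Set a
UnitBreak e = Σ ℕ λ m → e m ≢ e (suc m) × e (suc m) ≡ e (suc (suc m))

descent : ∀ {a} {A : Set a} → DecidableEquality A → (e : ℕ → A) →
          ∀ t → e t ≡ e (suc t) → ∀ {p} → p ≤ t → e 0 ≢ e p → UnitBreak e
descent _≟_ e zero    _    z≤n e₀≢eₚ = ⊥-elim (e₀≢eₚ refl)
descent _≟_ e (suc m) same p≤t e₀≢eₚ with e m ≟ e (suc m)
... | no  change = m , change , same
... | yes same′ with ℕP.m≤n⇒m<n∨m≡n p≤t
...   | inj₁ (s≤s p≤m) = descent _≟_ e m same′ p≤m e₀≢eₚ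
...   | inj₂ refl      = descent _≟_ e m same′ ℕP.≤-refl (λ e₀≡eₘ → e₀≢eₚ (trans e₀≡eₘ same′))

record DivisorStep (u v : ℕ) : Set where
  constructor divisorStep
  field
    gap     : ℕ
    gap>0   : 0 ℕ.< gap
    gap∣u   : gap ∣ u
    v≡u+gap : v ≡ u ℕ.+ gap

record DivisorChain (n : ℕ) : Set where
  field
    point   : Fin n → ℕ
    point>0 : ∀ i → 0 ℕ.< point i
    step    : ∀ {i j} → i F.< j → DivisorStep (point i) (point j)

  -- The product of all points; it is a common multiple of every gap.
  Π : ℕ
  Π = product (tabulate point)

  point∣Π : ∀ i → point i ∣ Π
  point∣Π i = ∈⇒∣product (∈-tabulate⁺ i)

  Π>0 : 0 ℕ.< Π
  Π>0 = ℕ.>-nonZero⁻¹ Π {{product≢0 (tabulate⁺ (ℕ.>-nonZero ∘ point>0))}}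

-- Adjoin Π below the translate Π + C: the new gaps are the points of C,
-- which divide Π, and the old gaps, which divide a point of C, hence Π.
extend : ∀ {n} → DivisorChain n → DivisorChain (suc n)
extend {n} C = record { point = point′ ; point>0 = point′>0 ; step = step′ }
  where
  open DivisorChain C
  point′ : Fin (suc n) → ℕ
  point′ F.zero    = Π
  point′ (F.suc i) = Π ℕ.+ point i
  point′>0 : ∀ i → 0 ℕ.< point′ i
  point′>0 F.zero    = Π>0
  point′>0 (F.suc i) = ℕP.<-≤-trans Π>0 (ℕP.m≤m+n Π (point i))
  step′ : ∀ {i j} → i F.< j → DivisorStep (point′ i) (point′ j)
  step′ {F.zero}  {F.suc j} _ = divisorStep (point j) (point>0 j) (point∣Π j) refl
  step′ {F.suc i} {F.suc j} (s≤s i<j) with divisorStep g g>0 g∣ eq ← step i<j =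
    divisorStep g g>0 (∣m∣n⇒∣m+n (∣-trans g∣ (point∣Π i)) g∣)
      (trans (cong (Π ℕ.+_) eq) (sym (ℕP.+-assoc Π (point i) g)))

divisorChain : ∀ n → DivisorChain n
divisorChain zero    = record { point = λ () ; point>0 = λ () ; step = λ { {()} } }
divisorChain (suc n) = extend (divisorChain n)

-- Arithmetic progressions in ℚ; n · s is the n-fold sum s + ⋯ + s.

·-positive : ∀ {n s} → 0 ℕ.< n → 0ℚ < s → 0ℚ < n · s
·-positive {suc zero}    _ s>0 = subst (0ℚ <_) (sym (ℚP.+-identityʳ _)) s>0
·-positive {suc (suc m)} _ s>0 = ℚP.+-mono-< s>0 (·-positive {suc m} ℕ.z<s s>0)

·1-positive : ∀ n .{{_ : ℕ.NonZero n}} → ℚ.Positive (n · 1ℚ)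
·1-positive n = ℚ.positive (·-positive (ℕ.>-nonZero⁻¹ n) (ℚP.positive⁻¹ 1ℚ))

module _ (n : ℕ) .{{_ : ℕ.NonZero n}} where

  private
    instance
      n·1-nonZero : ℚ.NonZero (n · 1ℚ)
      n·1-nonZero = ℚP.pos⇒nonZero (n · 1ℚ) {{·1-positive n}}

  slice : ℚ → ℚ
  slice d = 1/ (n · 1ℚ) * d

  slice-reaches : ∀ d → n · slice d ≡ d
  slice-reaches d = begin
    n · slice d                    ≡⟨ cong (n ·_) (ℚP.*-identityˡ (slice d)) ⟨
    n · (1ℚ * slice d)             ≡⟨ ×-assoc-* n 1ℚ (slice d) ⟨
    n · 1ℚ * (1/ (n · 1ℚ) * d)     ≡⟨ ℚP.*-assoc (n · 1ℚ) (1/ (n · 1ℚ)) d ⟨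
    n · 1ℚ * 1/ (n · 1ℚ) * d       ≡⟨ cong (_* d) (ℚP.*-inverseʳ (n · 1ℚ)) ⟩
    1ℚ * d                         ≡⟨ ℚP.*-identityˡ d ⟩
    d                              ∎
    where open ≡-Reasoning

  slice-positive : ∀ {d} → 0ℚ < d → 0ℚ < slice d
  slice-positive {d} d>0 = ℚP.positive⁻¹ (slice d)
    {{ℚP.pos*pos⇒pos (1/ (n · 1ℚ)) {{ℚP.1/pos⇒pos (n · 1ℚ) {{·1-positive n}}}}
                     d {{ℚ.positive d>0}}}}

module _ {k : ℕ} (c : Colouring k) (x : ℚ) where

  open +-*-Solver

  breakHomothet : ∀ {s} → 0ℚ < s → UnitBreak (λ t → c (x + t · s)) →
                  HasAlmostMonoHomothet c
  breakHomothet {s} s>0 (m , change , same) =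
    x + m · s , s , s>0 , trans (cong c (sym next₁)) (trans same (cong c next₂)) ,
    (λ eq → change (trans eq (cong c (sym next₁))))
    where
    next₁ : x + suc m · s ≡ (x + m · s) + s
    next₁ = solve 3 (λ x s u → x :+ (s :+ u) := (x :+ u) :+ s) refl x s (m · s)
    next₂ : x + suc (suc m) · s ≡ (x + m · s) + 2ℚ * s
    next₂ = solve 3 (λ x s u → x :+ (s :+ (s :+ u)) := (x :+ u) :+ (con 1ℚ :+ con 1ℚ) :* s)
                    refl x s (m · s)

  -- If the points u and u + g of the progression with step δ share a
  -- colour, where g > 0 divides u and some N ≤ u whose point is coloured
  -- differently from x, then descending along the coarser progression with
  -- step g·δ, from u down to N, finds a unit break.
  gapHomothet : ∀ {δ} → 0ℚ < δ → ∀ {N u g} → 0 ℕ.< g → g ∣ N → g ∣ u → N ≤ u →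
                c (x + u · δ) ≡ c (x + (u ℕ.+ g) · δ) → c x ≢ c (x + N · δ) →
                HasAlmostMonoHomothet c
  gapHomothet {δ} δ>0 {N} {u} {g} g>0 (divides p N≡p*g) (divides t u≡t*g) N≤u same differ =
    breakHomothet (·-positive g>0 δ>0)
      (descent F._≟_ coarse t coarse-same p≤t coarse-differ)
    where
    fine coarse : ℕ → Fin k
    fine   n = c (x + n · δ)
    coarse n = c (x + n · (g · δ))

    coarse≡fine : ∀ n → coarse n ≡ fine (n ℕ.* g)
    coarse≡fine n = cong (λ z → c (x + z)) (×-assocˡ δ n g)

    u+g≡[1+t]*g : u ℕ.+ g ≡ suc t ℕ.* g
    u+g≡[1+t]*g = trans (cong (ℕ._+ g) u≡t*g) (ℕP.+-comm (t ℕ.* g) g)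

    coarse-same : coarse t ≡ coarse (suc t)
    coarse-same = begin
      coarse t              ≡⟨ coarse≡fine t ⟩
      fine (t ℕ.* g)        ≡⟨ cong fine u≡t*g ⟨
      fine u                ≡⟨ same ⟩
      fine (u ℕ.+ g)        ≡⟨ cong fine u+g≡[1+t]*g ⟩
      fine (suc t ℕ.* g)    ≡⟨ coarse≡fine (suc t) ⟨
      coarse (suc t)        ∎
      where open ≡-Reasoning

    p≤t : p ≤ t
    p≤t = ℕP.*-cancelʳ-≤ p t g {{ℕ.>-nonZero g>0}} (subst₂ _≤_ N≡p*g u≡t*g N≤u)

    coarse-differ : coarse 0 ≢ coarse p
    coarse-differ eq = differ (begin
      c x              ≡⟨ cong c (ℚP.+-identityʳ x) ⟨
      coarse 0         ≡⟨ eq ⟩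
      coarse p         ≡⟨ coarse≡fine p ⟩
      fine (p ℕ.* g)   ≡⟨ cong fine N≡p*g ⟨
      fine N           ∎)
      where open ≡-Reasoning

-- The case x < y: pigeonhole on the k + 1 points x + (Π + aᵢ)·δ, where
-- a is a divisor chain of length k + 1 and Π·δ = y - x.
module _ {k : ℕ} (c : Colouring k) {x y : ℚ} (x<y : x < y) where

  open DivisorChain (divisorChain (suc k))

  private
    instance
      Π≢0 : ℕ.NonZero Π
      Π≢0 = ℕ.>-nonZero Π>0

    δ : ℚ
    δ = slice Π (y - x)

    δ>0 : 0ℚ < δ
    δ>0 = slice-positive Π (subst (_< y - x) (ℚP.+-inverseʳ x) (ℚP.+-monoˡ-< (ℚ.- x) x<y))

    x+Πδ≡y : x + Π · δ ≡ y
    x+Πδ≡y = trans (cong (x +_) (slice-reaches Π (y - x)))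
                   (solve 2 (λ x y → x :+ (y :- x) := y) refl x y)
      where open +-*-Solver

    at : ℕ → Fin k
    at n = c (x + n · δ)

  orderedHomothet : c x ≢ c y → HasAlmostMonoHomothet c
  orderedHomothet cx≢cy
    with i , j , i<j , same ← pigeonhole (ℕP.n<1+n k) (λ i → at (Π ℕ.+ point i))
    with divisorStep g g>0 g∣aᵢ aⱼ≡aᵢ+g ← step i<j =
    gapHomothet c x δ>0 g>0 g∣Π (∣m∣n⇒∣m+n g∣Π g∣aᵢ) (ℕP.m≤m+n Π (point i))
      (trans same (cong at Π+aⱼ≡Π+aᵢ+g)) (λ eq → cx≢cy (trans eq (cong c x+Πδ≡y)))
    where
    g∣Π : g ∣ Π
    g∣Π = ∣-trans g∣aᵢ (point∣Π i)

    Π+aⱼ≡Π+aᵢ+g : Π ℕ.+ point j ≡ Π ℕ.+ point i ℕ.+ g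
    Π+aⱼ≡Π+aᵢ+g = trans (cong (Π ℕ.+_) aⱼ≡aᵢ+g) (sym (ℕP.+-assoc Π (point i) g))

theorem1p6 : (k : ℕ) (c : Colouring k) → UsesMoreThanOneColour c →
    Σ ℚ λ a → Σ ℚ λ l → AlmostMonoHomothet c a l
theorem1p6 k c (x , y , cx≢cy) with ℚP.<-cmp x y
... | tri< x<y _ _ = orderedHomothet c x<y cx≢cy
... | tri≈ _ x≡y _ = ⊥-elim (cx≢cy (cong c x≡y))
... | tri> _ _ y<x = orderedHomothet c y<x (cx≢cy ∘ sym)
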